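{- A class $\mathcal{C}$ of SD-models is definable in $\mathcal{L}_{\mathsf{D}}$ (i.e., there is a formula $\varphi$ of $\mathcal{L}_{\mathsf{D}}$ such that for every SD-model $W$, $W\models\varphi$ iff $W\in\mathcal{C}$) if and only if $\mathcal{C}$ is closed under finite propositional equivalence.
   Context: Fix a countably infinite set $\mathit{PROP}$ of proposition symbols; assignments are maps $w:\mathit{PROP}\to\{0,1\}$; an SD-model is a (possibly empty) set $W$ of assignments. $\mathcal{L}_{\mathsf{D}}$: formulae $\varphi::=p\mid\neg\varphi\mid(\varphi\to\varphi)\mid\mathsf{D}(\varphi_1,\dots,\varphi_k;\psi)$ ($k\in\mathbb{N}$); $W,w\models p$ iff $w(p)=1$; $\neg,\to$ classical; $W,w\models\mathsf{D}(\varphi_1,\dots,\varphi_k;\psi)$ iff all $u,v\in W$ agreeing on the truth of each $\varphi_i$ agree on the truth of $\psi$. $W\models\varphi$ means $W,w\models\varphi$ for all $w\in W$. For $\Phi\subseteq\mathit{PROP}$, $W|_\Phi=\{w|_\Phi:w\in W\}$; $W_1,W_2$ are $\Phi$-equivalent if $W_1|_\Phi=W_2|_\Phi$. A class $\mathcal{C}$ of SD-models is closed under finite propositional equivalence if (1) $\emptyset\in\mathcal{C}$ and (2) there is a finite $\Phi\subseteq\mathit{PROP}$ such that for all nonempty SD-models $W_1,W_2$, if $W_1\in\mathcal{C}$ and $W_1,W_2$ are $\Phi$-equivalent then $W_2\in\mathcal{C}$. -}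

module Defs where

open import Data.Nat using (ℕ)
open import Data.Bool using (Bool; true)
open import Data.List using (List; []; _∷_)
open import Data.List.Membership.Propositional using (_∈_)
open import Data.Product using (_×_; ∃; _,_)
open import Data.Unit using (⊤)
open import Data.Empty using (⊥)
open import Relation.Nullary using (¬_)
open import Relation.Binary.PropositionalEquality using (_≡_)
open import Function.Bundles using (_⇔_)

PROP : Set
PROP = ℕ

Assignment : Set
Assignment = PROP → Bool

SDModel : Set₁
SDModel = Assignment → Set

SDClass : Set₂
SDClass = SDModel → Set₁

-- formulae of L_D; D(φ₁,…,φ_k; ψ) is  dep (φ₁ ∷ … ∷ φ_k ∷ []) ψ
data Formula : Set where
  prop : PROP → Formula
  neg  : Formula → Formula
  imp  : Formula → Formula → Formula
  dep  : List Formula → Formula → Formula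

mutual
  Sat : SDModel → Assignment → Formula → Set
  Sat W w (prop p)    = w p ≡ true
  Sat W w (neg φ)     = ¬ (Sat W w φ)
  Sat W w (imp φ ψ)   = Sat W w φ → Sat W w ψ
  Sat W w (dep φs ψ)  = ∀ u v → W u → W v → AgreeOn W φs u v → (Sat W u ψ ⇔ Sat W v ψ)

  AgreeOn : SDModel → List Formula → Assignment → Assignment → Set
  AgreeOn W []       u v = ⊤
  AgreeOn W (φ ∷ φs) u v = (Sat W u φ ⇔ Sat W v φ) × AgreeOn W φs u v

_⊨_ : SDModel → Formula → Set
W ⊨ φ = ∀ w → W w → Sat W w φ

Definable : SDClass → Set₁
Definable C = ∃ λ (φ : Formula) → ∀ (W : SDModel) → ((W ⊨ φ) → C W) × (C W → W ⊨ φ)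

Empty : SDModel → Set
Empty W = ∀ w → ¬ W w

Nonempty : SDModel → Set
Nonempty W = ∃ λ w → W w

-- finite sets Φ ⊆ PROP are represented by lists
AgreeOnProps : List PROP → Assignment → Assignment → Set
AgreeOnProps Φ u v = ∀ p → p ∈ Φ → u p ≡ v p

PropEquiv : List PROP → SDModel → SDModel → Set
PropEquiv Φ W₁ W₂ =
  (∀ u → W₁ u → ∃ λ v → W₂ v × AgreeOnProps Φ u v) ×
  (∀ v → W₂ v → ∃ λ u → W₁ u × AgreeOnProps Φ u v)

ClosedUnderFinitePropEquiv : SDClass → Set₁
ClosedUnderFinitePropEquiv C =
  (∀ W → Empty W → C W) ×
  ∃ λ (Φ : List PROP) → ∀ (W₁ W₂ : SDModel) → Nonempty W₁ → Nonempty W₂ →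
      C W₁ → PropEquiv Φ W₁ W₂ → C W₂

{-# OPTIONS --safe #-}
-- A formula φ sees only the propositions in props φ: by induction on φ, its truth is preserved
-- between props φ-equivalent models at worlds agreeing on props φ, the dependence atoms being
-- handled by the back-and-forth clauses of Φ-equivalence. Conversely, a nonempty model is
-- determined up to Φ-equivalence by the finite set of Φ-types it realises, and realisation of a
-- type t is expressed by ◇ (typeFormula Φ t), with ◇ built from the constancy atom D(; ·).
-- A decision tree that tests every type in turn and, at its leaves, holds iff the canonical model
-- realising exactly the collected types belongs to C, therefore defines C on nonempty models;
-- the empty model satisfies every formula. Excluded middle decides the leaves and gives the
-- classical reading of ∧ and ◇.
module Submission where

open import Defs
open import Level using (suc; zero; lift; lower)
open import Axiom.ExcludedMiddle using (ExcludedMiddle)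
open import Axiom.DoubleNegationElimination using (DoubleNegationElimination; em⇒dne)
open import Data.Bool using (Bool; true; false)
open import Data.Bool.Properties using (¬-not; not-¬)
open import Data.Empty using (⊥-elim)
open import Data.List using (List; []; _∷_; _++_; map)
open import Data.List.Properties using (∷-injective)
open import Data.List.Membership.Propositional using (_∈_)
open import Data.List.Membership.Propositional.Properties using (∈-map⁺; ∈-++⁺ˡ; ∈-++⁺ʳ)
open import Data.List.Relation.Binary.Subset.Propositional using (_⊆_)
open import Data.List.Relation.Binary.Subset.Propositional.Properties
  using (⊆-refl; ⊆-trans; xs⊆xs++ys; xs⊆ys++xs)
open import Data.List.Relation.Unary.Any as Any using (here; there)
open import Data.Product using (_×_; _,_; proj₁; proj₂; ∃)
open import Data.Product.Function.NonDependent.Propositional using (_×-⇔_)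
open import Data.Sum as Sum using (_⊎_; inj₁; inj₂)
open import Data.Unit using (tt)
open import Function using (id; _∘_)
open import Function.Bundles using (_⇔_; mk⇔; Equivalence)
open import Function.Construct.Composition using (_⇔-∘_)
open import Function.Construct.Identity using (⇔-id)
open import Function.Construct.Symmetry using (⇔-sym)
open import Function.Related.Propositional using (SymmetricKind)
open import Function.Related.TypeIsomorphisms using (¬-cong-⇔; →-cong-⇔; Related-cong)
open import Relation.Nullary using (¬_; Dec; yes; no)
open import Relation.Nullary.Decidable using (map′)
open import Relation.Binary.PropositionalEquality using (_≡_; refl; sym; trans; cong₂)

open Equivalence using (to; from)

private
  variable
    Φ : List PROP
    W W₁ W₂ : SDModel
    u v u′ v′ w : Assignment

mutual
  props : Formula → List PROP
  props (prop p)   = p ∷ []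
  props (neg φ)    = props φ
  props (imp φ ψ)  = props φ ++ props ψ
  props (dep φs ψ) = propsᴸ φs ++ props ψ

  propsᴸ : List Formula → List PROP
  propsᴸ []       = []
  propsᴸ (φ ∷ φs) = props φ ++ propsᴸ φs

++⊆⇒⊆ˡ : ∀ {A : Set} {xs ys zs : List A} → xs ++ ys ⊆ zs → xs ⊆ zs
++⊆⇒⊆ˡ {xs = xs} {ys} = ⊆-trans (xs⊆xs++ys xs ys)

++⊆⇒⊆ʳ : ∀ {A : Set} {xs ys zs : List A} → xs ++ ys ⊆ zs → ys ⊆ zs
++⊆⇒⊆ʳ {xs = xs} {ys} = ⊆-trans (xs⊆ys++xs ys xs)

AgreeOnProps-sym : AgreeOnProps Φ u v → AgreeOnProps Φ v u
AgreeOnProps-sym u≈v p p∈Φ = sym (u≈v p p∈Φ)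

PropEquiv-sym : PropEquiv Φ W₁ W₂ → PropEquiv Φ W₂ W₁
PropEquiv-sym (forth , back) =
  (λ v v∈ → let u , u∈ , u≈v = back v v∈ in u , u∈ , AgreeOnProps-sym u≈v) ,
  (λ u u∈ → let v , v∈ , u≈v = forth u u∈ in v , v∈ , AgreeOnProps-sym u≈v)

⇔-cong : ∀ {A B C D : Set} → A ⇔ B → C ⇔ D → (A ⇔ C) ⇔ (B ⇔ D)
⇔-cong = Related-cong {k = SymmetricKind.equivalence}

mutual
  Sat-invariant : ∀ φ → props φ ⊆ Φ → PropEquiv Φ W₁ W₂ →
                  W₁ u → W₂ v → AgreeOnProps Φ u v → Sat W₁ u φ ⇔ Sat W₂ v φ
  Sat-invariant (prop p) φ⊆Φ E _ _ u≈v =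
    mk⇔ (trans (sym (u≈v p (φ⊆Φ (here refl))))) (trans (u≈v p (φ⊆Φ (here refl))))
  Sat-invariant (neg φ) φ⊆Φ E u∈ v∈ u≈v = ¬-cong-⇔ (Sat-invariant φ φ⊆Φ E u∈ v∈ u≈v)
  Sat-invariant (imp φ ψ) φ⊆Φ E u∈ v∈ u≈v =
    →-cong-⇔ (Sat-invariant φ (++⊆⇒⊆ˡ φ⊆Φ) E u∈ v∈ u≈v) (Sat-invariant ψ (++⊆⇒⊆ʳ φ⊆Φ) E u∈ v∈ u≈v)
  Sat-invariant {u = u} {v = v} (dep φs ψ) φ⊆Φ E _ _ _ =
    mk⇔ (dep-invariant {u = u} {v = v} φs ψ φ⊆Φ E)
        (dep-invariant {u = v} {v = u} φs ψ φ⊆Φ (PropEquiv-sym E))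

  -- The truth of a dependence atom does not depend on the current world.
  dep-invariant : ∀ φs ψ → props (dep φs ψ) ⊆ Φ → PropEquiv Φ W₁ W₂ →
                  Sat W₁ u (dep φs ψ) → Sat W₂ v (dep φs ψ)
  dep-invariant {Φ = Φ} {W₁ = W₁} {W₂ = W₂} φs ψ φ⊆Φ E d u′ v′ u′∈ v′∈ u′≈v′
    with proj₂ E u′ u′∈ | proj₂ E v′ v′∈
  ... | u , u∈ , u≈u′ | v , v∈ , v≈v′ =
    ψ-invariant v∈ v′∈ v≈v′ ⇔-∘ (d u v u∈ v∈ u≈v ⇔-∘ ⇔-sym (ψ-invariant u∈ u′∈ u≈u′))
    where
      ψ-invariant : ∀ {x y} → W₁ x → W₂ y → AgreeOnProps Φ x y → Sat W₁ x ψ ⇔ Sat W₂ y ψ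
      ψ-invariant = Sat-invariant ψ (++⊆⇒⊆ʳ φ⊆Φ) E
      u≈v : AgreeOn W₁ φs u v
      u≈v = from (AgreeOn-invariant φs (++⊆⇒⊆ˡ φ⊆Φ) E u∈ u′∈ u≈u′ v∈ v′∈ v≈v′) u′≈v′

  AgreeOn-invariant : ∀ φs → propsᴸ φs ⊆ Φ → PropEquiv Φ W₁ W₂ →
                      W₁ u → W₂ u′ → AgreeOnProps Φ u u′ →
                      W₁ v → W₂ v′ → AgreeOnProps Φ v v′ →
                      AgreeOn W₁ φs u v ⇔ AgreeOn W₂ φs u′ v′
  AgreeOn-invariant [] _ _ _ _ _ _ _ _ = ⇔-id _
  AgreeOn-invariant {Φ = Φ} {W₁ = W₁} {W₂ = W₂} (φ ∷ φs) φs⊆Φ E u∈ u′∈ u≈u′ v∈ v′∈ v≈v′ =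
    ⇔-cong (φ-invariant u∈ u′∈ u≈u′) (φ-invariant v∈ v′∈ v≈v′) ×-⇔
    AgreeOn-invariant φs (++⊆⇒⊆ʳ φs⊆Φ) E u∈ u′∈ u≈u′ v∈ v′∈ v≈v′
    where
      φ-invariant : ∀ {x y} → W₁ x → W₂ y → AgreeOnProps Φ x y → Sat W₁ x φ ⇔ Sat W₂ y φ
      φ-invariant = Sat-invariant φ (++⊆⇒⊆ˡ φs⊆Φ) E

⊨-invariant : ∀ φ → props φ ⊆ Φ → PropEquiv Φ W₁ W₂ → W₁ ⊨ φ → W₂ ⊨ φ
⊨-invariant φ φ⊆Φ E W₁⊨φ v v∈ =
  let u , u∈ , u≈v = proj₂ E v v∈ in to (Sat-invariant φ φ⊆Φ E u∈ v∈ u≈v) (W₁⊨φ u u∈)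

definable⇒closed : (C : SDClass) → Definable C → ClosedUnderFinitePropEquiv C
definable⇒closed C (φ , defines) =
  (λ W W-empty → proj₁ (defines W) (λ w w∈ → ⊥-elim (W-empty w w∈))) ,
  props φ ,
  λ W₁ W₂ _ _ C-W₁ E → proj₁ (defines W₂) (⊨-invariant φ ⊆-refl E (proj₂ (defines W₁) C-W₁))

⊤ᶠ : Formula
⊤ᶠ = imp (prop 0) (prop 0)

⊥ᶠ : Formula
⊥ᶠ = neg ⊤ᶠ

_∧ᶠ_ : Formula → Formula → Formula
φ ∧ᶠ ψ = neg (imp φ (neg ψ))

-- D(; φ) says that φ has the same truth value at all worlds of the model.
□ : Formula → Formula
□ φ = dep [] φ ∧ᶠ φ

◇ : Formula → Formula
◇ φ = neg (□ (neg φ))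

if_then_else_ : Formula → Formula → Formula → Formula
if φ then ψ else χ = imp φ ψ ∧ᶠ imp (neg φ) χ

truth : ∀ {a} {P : Set a} → Dec P → Formula
truth (yes _) = ⊤ᶠ
truth (no _)  = ⊥ᶠ

truth-sem : ∀ {a} {P : Set a} (P? : Dec P) → Sat W w (truth P?) ⇔ P
truth-sem (yes p) = mk⇔ (λ _ → p) (λ _ → id)
truth-sem (no ¬p) = mk⇔ (λ ¬⊤ → ⊥-elim (¬⊤ id)) (λ p → ⊥-elim (¬p p))

literal : PROP → Bool → Formula
literal p true  = prop p
literal p false = neg (prop p)

literal-sem : ∀ p b → Sat W w (literal p b) ⇔ (w p ≡ b)
literal-sem p true  = ⇔-id _
literal-sem p false = mk⇔ ¬-not not-¬

type : List PROP → Assignment → List Bool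
type Φ w = map w Φ

typeFormula : List PROP → List Bool → Formula
typeFormula []      []      = ⊤ᶠ
typeFormula (p ∷ Φ) (b ∷ t) = literal p b ∧ᶠ typeFormula Φ t
typeFormula []      (_ ∷ _) = ⊥ᶠ
typeFormula (_ ∷ _) []      = ⊥ᶠ

module Classical (dne : DoubleNegationElimination zero) where

  ∧ᶠ-sem : ∀ φ ψ → Sat W w (φ ∧ᶠ ψ) ⇔ (Sat W w φ × Sat W w ψ)
  ∧ᶠ-sem φ ψ = mk⇔
    (λ ¬[φ→¬ψ] → dne (λ ¬φ → ¬[φ→¬ψ] (⊥-elim ∘ ¬φ)) , dne (λ ¬ψ → ¬[φ→¬ψ] (λ _ → ¬ψ)))
    (λ (φ-holds , ψ-holds) φ→¬ψ → φ→¬ψ φ-holds ψ-holds)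

  □-sem : ∀ φ → W w → Sat W w (□ φ) ⇔ (∀ u → W u → Sat W u φ)
  □-sem {w = w} φ w∈ = mk⇔
    (λ □φ u u∈ → let constant , φ-at-w = to (∧ᶠ-sem (dep [] φ) φ) □φ in
                 to (constant w u w∈ u∈ tt) φ-at-w)
    (λ φ-everywhere → from (∧ᶠ-sem (dep [] φ) φ)
      ( (λ u v u∈ v∈ _ → mk⇔ (λ _ → φ-everywhere v v∈) (λ _ → φ-everywhere u u∈))
      , φ-everywhere w w∈))

  ◇-sem : ∀ φ → W w → Sat W w (◇ φ) ⇔ (∃ λ u → W u × Sat W u φ)
  ◇-sem φ w∈ = mk⇔
    (λ ◇φ → dne (λ ∄ → ◇φ (from (□-sem (neg φ) w∈) (λ u u∈ φ-at-u → ∄ (u , u∈ , φ-at-u)))))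
    (λ (u , u∈ , φ-at-u) □¬φ → to (□-sem (neg φ) w∈) □¬φ u u∈ φ-at-u)

  if-true : ∀ φ ψ χ → Sat W w φ → Sat W w (if φ then ψ else χ) ⇔ Sat W w ψ
  if-true φ ψ χ φ-holds = mk⇔
    (λ h → proj₁ (to (∧ᶠ-sem (imp φ ψ) (imp (neg φ) χ)) h) φ-holds)
    (λ ψ-holds → from (∧ᶠ-sem (imp φ ψ) (imp (neg φ) χ))
                      ((λ _ → ψ-holds) , λ ¬φ → ⊥-elim (¬φ φ-holds)))

  if-false : ∀ φ ψ χ → ¬ Sat W w φ → Sat W w (if φ then ψ else χ) ⇔ Sat W w χ
  if-false φ ψ χ ¬φ = mk⇔
    (λ h → proj₂ (to (∧ᶠ-sem (imp φ ψ) (imp (neg φ) χ)) h) ¬φ)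
    (λ χ-holds → from (∧ᶠ-sem (imp φ ψ) (imp (neg φ) χ))
                      ((λ φ-holds → ⊥-elim (¬φ φ-holds)) , λ _ → χ-holds))

  typeFormula-sem : ∀ Φ t → Sat W w (typeFormula Φ t) ⇔ (type Φ w ≡ t)
  typeFormula-sem []      []      = mk⇔ (λ _ → refl) (λ _ → id)
  typeFormula-sem (p ∷ Φ) (b ∷ t) =
    mk⇔ (λ (p≡b , Φ≡t) → cong₂ _∷_ p≡b Φ≡t) ∷-injective ⇔-∘
    ((literal-sem p b ×-⇔ typeFormula-sem Φ t) ⇔-∘ ∧ᶠ-sem (literal p b) (typeFormula Φ t))
  typeFormula-sem []      (_ ∷ _) = mk⇔ (λ ¬⊤ → ⊥-elim (¬⊤ id)) (λ ())
  typeFormula-sem (_ ∷ _) []      = mk⇔ (λ ¬⊤ → ⊥-elim (¬⊤ id)) (λ ())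

types : List PROP → List (List Bool)
types []      = [] ∷ []
types (p ∷ Φ) = map (true ∷_) (types Φ) ++ map (false ∷_) (types Φ)

type∈types : ∀ Φ w → type Φ w ∈ types Φ
type∈types []      w = here refl
type∈types (p ∷ Φ) w with w p
... | true  = ∈-++⁺ˡ (∈-map⁺ (true ∷_) (type∈types Φ w))
... | false = ∈-++⁺ʳ (map (true ∷_) (types Φ)) (∈-map⁺ (false ∷_) (type∈types Φ w))

type≡⇒AgreeOnProps : ∀ Φ → type Φ u ≡ type Φ v → AgreeOnProps Φ u v
type≡⇒AgreeOnProps (q ∷ Φ) u≡v p (here refl) = proj₁ (∷-injective u≡v)
type≡⇒AgreeOnProps (q ∷ Φ) u≡v p (there p∈Φ) = type≡⇒AgreeOnProps Φ (proj₂ (∷-injective u≡v)) p p∈Φ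

Realises : List PROP → SDModel → List Bool → Set
Realises Φ W t = ∃ λ u → W u × type Φ u ≡ t

canonical : List PROP → List (List Bool) → SDModel
canonical Φ β w = type Φ w ∈ β

PropEquiv-canonical : ∀ {β} → (∀ u → W u → type Φ u ∈ β) → (∀ t → t ∈ β → Realises Φ W t) →
                      PropEquiv Φ W (canonical Φ β)
PropEquiv-canonical {Φ = Φ} W⊆β β⊆W =
  (λ u u∈ → u , W⊆β u u∈ , λ _ _ → refl) ,
  (λ v v∈ → let u , u∈ , u≡v = β⊆W (type Φ v) v∈ in u , u∈ , type≡⇒AgreeOnProps Φ u≡v)

ClosedUnder : List PROP → SDClass → Set₁
ClosedUnder Φ C = ∀ W₁ W₂ → Nonempty W₁ → Nonempty W₂ → C W₁ → PropEquiv Φ W₁ W₂ → C W₂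

ClosedUnder⇒⇔ : ∀ {C} → ClosedUnder Φ C → Nonempty W₁ → Nonempty W₂ → PropEquiv Φ W₁ W₂ → C W₁ ⇔ C W₂
ClosedUnder⇒⇔ {W₁ = W₁} {W₂ = W₂} closed ne₁ ne₂ E =
  mk⇔ (λ C-W₁ → closed W₁ W₂ ne₁ ne₂ C-W₁ E) (λ C-W₂ → closed W₂ W₁ ne₂ ne₁ C-W₂ (PropEquiv-sym E))

∈-⊎-shift : ∀ {A : Set} {x y : A} {xs ys} → x ∈ xs ⊎ x ∈ y ∷ ys → x ∈ y ∷ xs ⊎ x ∈ ys
∈-⊎-shift (inj₁ x∈xs)         = inj₁ (there x∈xs)
∈-⊎-shift (inj₂ (here x≡y))   = inj₁ (here x≡y)
∈-⊎-shift (inj₂ (there x∈ys)) = inj₂ x∈ys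

module CharacteristicFormula (lem : ExcludedMiddle (suc zero)) (Φ : List PROP) (C : SDClass)
                             (closed : ClosedUnder Φ C) where

  lem₀ : ExcludedMiddle zero
  lem₀ = map′ lower lift lem

  open Classical (em⇒dne lem₀)

  ◇typeFormula-sem : ∀ t → W w → Sat W w (◇ (typeFormula Φ t)) ⇔ Realises Φ W t
  ◇typeFormula-sem t w∈ =
    mk⇔ (λ (u , u∈ , t-at-u) → u , u∈ , to (typeFormula-sem Φ t) t-at-u)
        (λ (u , u∈ , u-has-t) → u , u∈ , from (typeFormula-sem Φ t) u-has-t)
    ⇔-∘ ◇-sem (typeFormula Φ t) w∈

  -- Walking through the candidate types ts, β collects those realised in W; at a leaf β is
  -- exactly the set of types realised in W, so W is Φ-equivalent to canonical Φ β.
  decisionTree : List (List Bool) → List (List Bool) → Formula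
  decisionTree []       β = truth (lem {C (canonical Φ β)})
  decisionTree (t ∷ ts) β =
    if ◇ (typeFormula Φ t) then decisionTree ts (t ∷ β) else decisionTree ts β

  decisionTree-sem : W w → ∀ ts β →
                     (∀ u → W u → type Φ u ∈ β ⊎ type Φ u ∈ ts) → (∀ t → t ∈ β → Realises Φ W t) →
                     Sat W w (decisionTree ts β) ⇔ C W
  decisionTree-sem {W = W} {w = w} w∈ [] β W⊆β⊎[] β⊆W =
    ⇔-sym (ClosedUnder⇒⇔ closed (w , w∈) (w , W⊆β w w∈) (PropEquiv-canonical W⊆β β⊆W))
    ⇔-∘ truth-sem lem
    where
      W⊆β : ∀ u → W u → type Φ u ∈ β
      W⊆β u u∈ with W⊆β⊎[] u u∈
      ... | inj₁ type∈β = type∈β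
  decisionTree-sem {W = W} w∈ (t ∷ ts) β W⊆β⊎ts β⊆W with lem₀ {Realises Φ W t}
  ... | yes t-realised =
    decisionTree-sem w∈ ts (t ∷ β) (λ u → ∈-⊎-shift ∘ W⊆β⊎ts u) t∷β⊆W
    ⇔-∘ if-true (◇ (typeFormula Φ t)) (decisionTree ts (t ∷ β)) (decisionTree ts β)
                (from (◇typeFormula-sem t w∈) t-realised)
    where
      t∷β⊆W : ∀ t′ → t′ ∈ t ∷ β → Realises Φ W t′
      t∷β⊆W _ (here refl)  = t-realised
      t∷β⊆W t′ (there t′∈β) = β⊆W t′ t′∈β
  ... | no t-unrealised =
    decisionTree-sem w∈ ts β W⊆β⊎ts′ β⊆W
    ⇔-∘ if-false (◇ (typeFormula Φ t)) (decisionTree ts (t ∷ β)) (decisionTree ts β)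
                 (t-unrealised ∘ to (◇typeFormula-sem t w∈))
    where
      W⊆β⊎ts′ : ∀ u → W u → type Φ u ∈ β ⊎ type Φ u ∈ ts
      W⊆β⊎ts′ u u∈ = Sum.map₂ (Any.tail (λ u-has-t → t-unrealised (u , u∈ , u-has-t))) (W⊆β⊎ts u u∈)

  characteristic : Formula
  characteristic = decisionTree (types Φ) []

  characteristic-sem : W w → Sat W w characteristic ⇔ C W
  characteristic-sem w∈ = decisionTree-sem w∈ (types Φ) [] (λ u _ → inj₂ (type∈types Φ u)) (λ _ ())

  characteristic-defines : (∀ W → Empty W → C W) →
                           ∀ W → (W ⊨ characteristic → C W) × (C W → W ⊨ characteristic)
  characteristic-defines C-empty W = ⊨⇒C , λ C-W u u∈ → from (characteristic-sem u∈) C-W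
    where
      ⊨⇒C : W ⊨ characteristic → C W
      ⊨⇒C W⊨χ with lem₀ {Nonempty W}
      ... | yes (w , w∈) = to (characteristic-sem w∈) (W⊨χ w w∈)
      ... | no W-empty   = C-empty W (λ w w∈ → W-empty (w , w∈))

closed⇒definable : ExcludedMiddle (suc zero) → (C : SDClass) → ClosedUnderFinitePropEquiv C → Definable C
closed⇒definable lem C (C-empty , Φ , closed) = characteristic , characteristic-defines C-empty
  where open CharacteristicFormula lem Φ C closed

corollary3p8 : ExcludedMiddle (suc zero) → (C : SDClass) →
    (Definable C → ClosedUnderFinitePropEquiv C) × (ClosedUnderFinitePropEquiv C → Definable C)
corollary3p8 lem C = definable⇒closed C , closed⇒definable lem C
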